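{- Let $\mathbf A=(A,\wedge,\vee,\cdot,\backslash,\slash)$ be a residuated binar whose lattice reduct $(A,\wedge,\vee)$ is distributive. If $\mathbf A$ satisfies both identities $$(x\vee y)\slash z = x\slash z\vee y\slash z \qquad\text{and}\qquad (x\wedge y)\backslash z = x\backslash z\vee y\backslash z$$ (for all $x,y,z\in A$), then $\mathbf A$ also satisfies the identity $$x\backslash (y\vee z) = x\backslash y\vee x\backslash z$$ for all $x,y,z\in A$.
   Context: A residuated binar is an algebra $\mathbf A=(A,\wedge,\vee,\cdot,\backslash,\slash)$ where $(A,\wedge,\vee)$ is a lattice, $\cdot$ is a binary operation on $A$ (written $xy$), and for all $x,y,z\in A$: $x\cdot y\le z \iff x\le z\slash y \iff y\le x\backslash z$. Convention: $\cdot$ binds more tightly than $\backslash,\slash$, which bind more tightly than $\wedge,\vee$. -}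

module Defs where

open import Level using (Level; _⊔_; suc)
open import Algebra.Core using (Op₂)
open import Algebra.Lattice.Bundles using (Lattice)
open import Algebra.Lattice.Structures using (IsDistributiveLattice)
open import Function.Bundles using (_⇔_)

record ResiduatedBinar c ℓ : Set (suc (c ⊔ ℓ)) where
  infixl 8 _·_
  infixr 7 _\\_
  infixl 7 _/_
  field
    lattice : Lattice c ℓ
  open Lattice lattice public
  field
    _·_  : Op₂ Carrier
    _\\_ : Op₂ Carrier
    _/_  : Op₂ Carrier

  _≤_ : Carrier → Carrier → Set ℓ
  x ≤ y = x ≈ x ∧ y
  infix 4 _≤_

  field
    residuation-/ : ∀ x y z → (x · y ≤ z) ⇔ (x ≤ z / y)
    residuation-\\ : ∀ x y z → (x · y ≤ z) ⇔ (y ≤ x \\ z)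

IsDistributive : ∀ {c ℓ} → ResiduatedBinar c ℓ → Set (c ⊔ ℓ)
IsDistributive A = IsDistributiveLattice _≈_ _∨_ _∧_
  where open ResiduatedBinar A

-- Put u = x \ (y ∨ z), p = y / u and q = z / u. Since x · u ≤ y ∨ z, the first identity
-- gives x ≤ p ∨ q, while p · u ≤ y and q · u ≤ z give u ≤ p \ y and u ≤ q \ z. Moreover
-- (p ∧ q) · u ≤ y ∧ z, so by the second identity u ≤ p \ (y ∧ z) ∨ q \ (y ∧ z) ≤ q \ y ∨ p \ z.
-- Thus u lies below each of p\y ∨ p\z, p\y ∨ q\z, q\y ∨ p\z, q\y ∨ q\z, and distributivity
-- puts it below (p\y ∧ q\y) ∨ (p\z ∧ q\z) ≤ (p ∨ q)\y ∨ (p ∨ q)\z ≤ x\y ∨ x\z.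
module Submission where

open import Defs
open import Function.Bundles using (Equivalence)
open import Algebra.Lattice.Bundles using (Lattice)
open import Algebra.Lattice.Structures using (IsDistributiveLattice)
import Algebra.Lattice.Properties.Lattice as LatticeProperties
import Relation.Binary.Lattice.Bundles as OrderLattice

module LatticeOrder {c ℓ} (L : Lattice c ℓ) where
  open OrderLattice.Lattice (LatticeProperties.∨-∧-orderTheoreticLattice L) public
    using (_≤_; x≤x∨y; y≤x∨y; ∨-least; x∧y≤x; x∧y≤y; ∧-greatest; antisym; ≤-respʳ-≈)
    renaming (refl to ≤-refl; trans to ≤-trans)
  open Lattice L using (_∨_; _∧_; sym)

  ∨-mono-≤ : ∀ {a b c d} → a ≤ b → c ≤ d → a ∨ c ≤ b ∨ d
  ∨-mono-≤ a≤b c≤d = ∨-least (≤-trans a≤b (x≤x∨y _ _)) (≤-trans c≤d (y≤x∨y _ _))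

  module _ (dist : IsDistributiveLattice (Lattice._≈_ L) _∨_ _∧_) where
    open IsDistributiveLattice dist using (∨-distribˡ-∧; ∨-distribʳ-∧)

    ≤-∧-∨-∧ : ∀ {u a b c d} → u ≤ a ∨ c → u ≤ a ∨ d → u ≤ b ∨ c → u ≤ b ∨ d →
              u ≤ (a ∧ b) ∨ (c ∧ d)
    ≤-∧-∨-∧ {a = a} {b} {c} {d} u≤a∨c u≤a∨d u≤b∨c u≤b∨d =
      ≤-respʳ-≈ (sym (∨-distribˡ-∧ (a ∧ b) c d))
        (∧-greatest (≤-respʳ-≈ (sym (∨-distribʳ-∧ c a b)) (∧-greatest u≤a∨c u≤b∨c))
                    (≤-respʳ-≈ (sym (∨-distribʳ-∧ d a b)) (∧-greatest u≤a∨d u≤b∨d)))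

module ResiduatedBinarProperties {c ℓ} (A : ResiduatedBinar c ℓ) where
  open ResiduatedBinar A hiding (_≤_)
  open LatticeOrder lattice public

  ·≤⇒≤/ : ∀ {a b d} → a · b ≤ d → a ≤ d / b
  ·≤⇒≤/ {a} {b} {d} = Equivalence.to (residuation-/ a b d)

  ≤/⇒·≤ : ∀ {a b d} → a ≤ d / b → a · b ≤ d
  ≤/⇒·≤ {a} {b} {d} = Equivalence.from (residuation-/ a b d)

  ·≤⇒≤\\ : ∀ {a b d} → a · b ≤ d → b ≤ a \\ d
  ·≤⇒≤\\ {a} {b} {d} = Equivalence.to (residuation-\\ a b d)

  ≤\\⇒·≤ : ∀ {a b d} → b ≤ a \\ d → a · b ≤ d
  ≤\\⇒·≤ {a} {b} {d} = Equivalence.from (residuation-\\ a b d)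

  /-·-≤ : ∀ d b → (d / b) · b ≤ d
  /-·-≤ d b = ≤/⇒·≤ ≤-refl

  ·-\\-≤ : ∀ a d → a · (a \\ d) ≤ d
  ·-\\-≤ a d = ≤\\⇒·≤ ≤-refl

  ·-monoˡ-≤ : ∀ {a b} c → a ≤ b → a · c ≤ b · c
  ·-monoˡ-≤ c a≤b = ≤/⇒·≤ (≤-trans a≤b (·≤⇒≤/ ≤-refl))

  \\-monoʳ-≤ : ∀ a {d e} → d ≤ e → a \\ d ≤ a \\ e
  \\-monoʳ-≤ a d≤e = ·≤⇒≤\\ (≤-trans (·-\\-≤ a _) d≤e)

  \\-antiˡ-≤ : ∀ {a b} d → a ≤ b → b \\ d ≤ a \\ d
  \\-antiˡ-≤ d a≤b = ·≤⇒≤\\ (≤-trans (·-monoˡ-≤ _ a≤b) (·-\\-≤ _ d))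

  -- The left residual / is what makes (p ∨ q) · v a join of p · v and q · v.
  \\-∧-≤-∨-\\ : ∀ p q d → (p \\ d) ∧ (q \\ d) ≤ (p ∨ q) \\ d
  \\-∧-≤-∨-\\ p q d = ·≤⇒≤\\ (≤/⇒·≤ (∨-least
    (·≤⇒≤/ (≤\\⇒·≤ (x∧y≤x _ _)))
    (·≤⇒≤/ (≤\\⇒·≤ (x∧y≤y _ _)))))

  \\-∨-≥ : ∀ x y z → (x \\ y) ∨ (x \\ z) ≤ x \\ (y ∨ z)
  \\-∨-≥ x y z = ∨-least (\\-monoʳ-≤ x (x≤x∨y y z)) (\\-monoʳ-≤ x (y≤x∨y y z))

  module _ (dist : IsDistributive A)
           (/-distribʳ-∨ : ∀ x y z → (x ∨ y) / z ≈ (x / z) ∨ (y / z))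
           (\\-∧-distribʳ-∨ : ∀ x y z → (x ∧ y) \\ z ≈ (x \\ z) ∨ (y \\ z)) where

    \\-∨-≤ : ∀ x y z → x \\ (y ∨ z) ≤ (x \\ y) ∨ (x \\ z)
    \\-∨-≤ x y z = ≤-trans u≤∧∨∧ (∨-mono-≤ (bound y) (bound z))
      where
      u = x \\ (y ∨ z)
      p = y / u
      q = z / u

      x≤p∨q : x ≤ p ∨ q
      x≤p∨q = ≤-respʳ-≈ (/-distribʳ-∨ y z u) (·≤⇒≤/ (·-\\-≤ x (y ∨ z)))

      u≤p\\y : u ≤ p \\ y
      u≤p\\y = ·≤⇒≤\\ (/-·-≤ y u)

      u≤q\\z : u ≤ q \\ z
      u≤q\\z = ·≤⇒≤\\ (/-·-≤ z u)

      u≤p∧q\\y∧z : u ≤ (p ∧ q) \\ (y ∧ z)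
      u≤p∧q\\y∧z = ·≤⇒≤\\ (∧-greatest
        (≤-trans (·-monoˡ-≤ u (x∧y≤x p q)) (/-·-≤ y u))
        (≤-trans (·-monoˡ-≤ u (x∧y≤y p q)) (/-·-≤ z u)))

      u≤q\\y∨p\\z : u ≤ (q \\ y) ∨ (p \\ z)
      u≤q\\y∨p\\z = ≤-trans u≤p∧q\\y∧z
        (≤-trans (≤-respʳ-≈ (\\-∧-distribʳ-∨ p q (y ∧ z)) ≤-refl) (∨-least
          (≤-trans (\\-monoʳ-≤ p (x∧y≤y y z)) (y≤x∨y _ _))
          (≤-trans (\\-monoʳ-≤ q (x∧y≤x y z)) (x≤x∨y _ _))))

      u≤∧∨∧ : u ≤ ((p \\ y) ∧ (q \\ y)) ∨ ((p \\ z) ∧ (q \\ z))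
      u≤∧∨∧ = ≤-∧-∨-∧ dist
        (≤-trans u≤p\\y (x≤x∨y _ _)) (≤-trans u≤p\\y (x≤x∨y _ _))
        u≤q\\y∨p\\z (≤-trans u≤q\\z (y≤x∨y _ _))

      bound : ∀ d → (p \\ d) ∧ (q \\ d) ≤ x \\ d
      bound d = ≤-trans (\\-∧-≤-∨-\\ p q d) (\\-antiˡ-≤ d x≤p∨q)

proposition2p1 : ∀ {c ℓ} (A : ResiduatedBinar c ℓ) → IsDistributive A →
    let open ResiduatedBinar A in
    (∀ x y z → (x ∨ y) / z ≈ (x / z) ∨ (y / z)) →
    (∀ x y z → (x ∧ y) \\ z ≈ (x \\ z) ∨ (y \\ z)) →
    ∀ x y z → x \\ (y ∨ z) ≈ (x \\ y) ∨ (x \\ z)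
proposition2p1 A dist /-distribʳ-∨ \\-∧-distribʳ-∨ x y z =
  antisym (\\-∨-≤ dist /-distribʳ-∨ \\-∧-distribʳ-∨ x y z) (\\-∨-≥ x y z)
  where open ResiduatedBinarProperties A
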